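{- Let $n=p_1^{n_1}\cdots p_r^{n_r}$ with primes $p_1<\cdots<p_r$, positive integers $n_i$, and $r\geq 3$. If $a,b\in[r]$ with $a<b$, then $|Q_a^1|>|Q_b^1|$, and consequently $|Z_a^1|>|Z_b^1|$.
   Context: $C_n$ is the cyclic group of order $n$; $[m]=\{1,\dots,m\}$. For a divisor $d$ of $n$, $E_d$ is the set of elements of $C_n$ of order $d$ and $S_d$ is the unique subgroup of order $d$. For $a\in[r]$, $s\in[n_a]$: $Q_a^s$ is the union of the subgroups $S_{n/(p_ip_a^s)}$ over $i\in[r]\setminus\{a\}$, and $Z_a^s:=E_n\cup E_{n/p_a}\cup\cdots\cup E_{n/p_a^{s-1}}\cup Q_a^s$ (so $Z_a^1=E_n\cup Q_a^1$). -}

module Defs where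

open import Data.Nat using (ℕ; zero; suc; _*_; _<_; _/_)
open import Data.Nat.Divisibility using (_∣_; _∣?_)
open import Data.Fin using (Fin; toℕ; _≟_)
open import Data.Fin.Properties using (any?; all?)
open import Data.Fin.Subset using (Subset; inside; outside; _∪_)
open import Data.Vec using (tabulate)
open import Data.Product using (∃; _×_)
open import Data.Bool using (if_then_else_)
open import Relation.Nullary using (¬_; Dec; does; yes; no)
open import Relation.Nullary.Decidable using (_×-dec_; ¬?)
open import Relation.Unary using (Pred; Decidable)
open import Data.Nat.ListAction using (product)
import Level
import Data.List as List

-- The cyclic group C_n is modelled as Fin n = {0,…,n-1} under addition mod n.
-- For k : ℕ and x : Fin n, the k-th multiple k·x is the identity iff n ∣ k * toℕ x.
IsIdMultiple : (n k : ℕ) → Fin n → Set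
IsIdMultiple n k x = n ∣ k * toℕ x

toSubset : ∀ {n} {P : Pred (Fin n) Level.zero} → Decidable P → Subset n
toSubset P? = tabulate (λ x → if does (P? x) then inside else outside)

-- Safe natural division (the divisor is always nonzero where it is used).
quot : ℕ → ℕ → ℕ
quot m zero    = 0
quot m (suc k) = m / suc k

-- S_d : the (unique) subgroup of order d of C_n (for d ∣ n),
-- namely { x ∈ C_n : d·x = 0 }.
S : (n d : ℕ) → Subset n
S n d = toSubset {n} {λ x → IsIdMultiple n d x} (λ x → n ∣? (d * toℕ x))

HasOrder : (n d : ℕ) → Fin n → Set
HasOrder n d x = IsIdMultiple n d x × (∀ (k : Fin d) → 0 < toℕ k → ¬ IsIdMultiple n (toℕ k) x)

hasOrder? : (n d : ℕ) → Decidable (HasOrder n d)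
hasOrder? n d x = (n ∣? (d * toℕ x)) ×-dec all? (λ k → ((0 Data.Nat.<? toℕ k)) →-dec ¬? (n ∣? (toℕ k * toℕ x)))
  where
  open import Relation.Nullary.Decidable using (_→-dec_)

E : (n d : ℕ) → Subset n
E n d = toSubset (hasOrder? n d)

-- Q_a^1 = ⋃_{i ≠ a} S_{n/(p_i p_a)}, for primes p : Fin r → ℕ.
InQ1 : (n r : ℕ) (p : Fin r → ℕ) (a : Fin r) → Fin n → Set
InQ1 n r p a x = ∃ λ (i : Fin r) → (¬ i ≡ a) × IsIdMultiple n (quot n (p i * p a)) x
  where open import Relation.Binary.PropositionalEquality using (_≡_)

Q1 : (n r : ℕ) (p : Fin r → ℕ) (a : Fin r) → Subset n
Q1 n r p a = toSubset {n} {InQ1 n r p a}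
  (λ x → any? (λ i → ¬? (i ≟ a) ×-dec (n ∣? (quot n (p i * p a) * toℕ x))))

Z1 : (n r : ℕ) (p : Fin r → ℕ) (a : Fin r) → Subset n
Z1 n r p a = E n n ∪ Q1 n r p a

prodFin : (r : ℕ) → (Fin r → ℕ) → ℕ
prodFin r f = product (List.tabulate f)

module Submission where

-- An element x of ℤ/n lies in Q_a^1 iff p_a ∣ x and p_i ∣ x for some i ≠ a; substituting x = y p_a,
-- |Q_a^1| counts the y < n/p_a divisible by some p_i with i ≠ a. For another index c write n = L p_a p_c
-- and split these y according to whether some p_i with i ∉ {a, c} divides y (the remaining ones are the
-- multiples of p_c, counted by y/p_c < L):
--   |Q_a^1| = #{y < L p_c : p_i ∣ y for some i ∉ {a,c}} + #{y < L : p_i ∤ y for all i ∉ {a,c}}.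
-- The formula for |Q_c^1| has L p_a in place of L p_c. As p_a < p_c, and r ≥ 3 provides a p_k ∣ L with
-- k ∉ {a, c} that witnesses L p_a in the first set, |Q_a^1| > |Q_c^1|. Since E_n is disjoint from Q_a^1,
-- |Z_a^1| = |E_n| + |Q_a^1|.

open import Defs
open import Algebra.Properties.CommutativeSemigroup using (interchange)
open import Data.Bool using (if_then_else_)
open import Data.Fin using (Fin; toℕ; fromℕ<; punchIn; punchOut)
import Data.Fin as F
import Data.Fin.Properties as Finₚ
open import Data.Fin.Properties using (any?; toℕ-fromℕ<; punchInᵢ≢i; punchIn-injective; punchIn-punchOut)
open import Data.Fin.Subset using (Subset; inside; outside; ∣_∣; _∪_; _∩_; _∈_; Empty)
open import Data.Fin.Subset.Properties using (x∈p∩q⁻; drop-∷-Empty)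
open import Data.List.Membership.Propositional.Properties using (∈-tabulate⁺)
open import Data.List.Relation.Unary.All.Properties using (tabulate⁺)
open import Data.Nat
  using (ℕ; zero; suc; _+_; _*_; _^_; _≤_; _<_; z≤n; s≤s; NonZero; ≢-nonZero; ≢-nonZero⁻¹; >-nonZero⁻¹; nonTrivial⇒n>1)
open import Data.Nat.Properties
open import Data.Nat.Divisibility
open import Data.Nat.DivMod using (m/n*n≡m)
open import Data.Nat.ListAction.Properties using (∈⇒∣product; product≢0)
open import Data.Nat.Primality
  using (Prime; euclidsLemma; prime⇒irreducible; prime⇒nonZero; prime⇒nonTrivial; ¬prime[1])
open import Data.Product using (_×_; _,_; proj₁; ∃-syntax)
open import Data.Sum using (_⊎_; inj₁; inj₂)
open import Data.Vec using ([]; _∷_; here)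
open import Data.Vec.Properties using ([]=⇒lookup; lookup∘tabulate)
open import Function using (_∘_; _⇔_; mk⇔; Injective; Equivalence)
open import Level using (0ℓ)
open import Relation.Binary using (tri<; tri≈; tri>)
open import Relation.Binary.PropositionalEquality
  using (_≡_; _≢_; refl; sym; trans; cong; cong₂; subst; subst₂; module ≡-Reasoning)
open import Relation.Nullary using (¬_; Dec; yes; no; does; contradiction)
open import Relation.Nullary.Decidable using (¬?; _×-dec_; _⊎-dec_)
open import Relation.Unary using (Pred; Decidable; _≐_)
open import Relation.Unary.Properties using (_∪?_; ∁?)

indicator : ∀ {A : Set} → Dec A → ℕ
indicator (yes _) = 1
indicator (no _)  = 0

indicator-cong : ∀ {A B : Set} → A ⇔ B → (a? : Dec A) (b? : Dec B) → indicator a? ≡ indicator b?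
indicator-cong A⇔B (yes _) (yes _) = refl
indicator-cong A⇔B (yes a) (no ¬b) = contradiction (Equivalence.to A⇔B a) ¬b
indicator-cong A⇔B (no ¬a) (yes b) = contradiction (Equivalence.from A⇔B b) ¬a
indicator-cong A⇔B (no _)  (no _)  = refl

count : {P : Pred ℕ 0ℓ} → Decidable P → ℕ → ℕ
count P? zero    = 0
count P? (suc N) = indicator (P? 0) + count (P? ∘ suc) N

count-cong : ∀ {P Q : Pred ℕ 0ℓ} (P? : Decidable P) (Q? : Decidable Q) → P ≐ Q →
             ∀ N → count P? N ≡ count Q? N
count-cong P? Q? (P⊆Q , Q⊆P) zero    = refl
count-cong P? Q? (P⊆Q , Q⊆P) (suc N) =
  cong₂ _+_ (indicator-cong (mk⇔ P⊆Q Q⊆P) (P? 0) (Q? 0)) (count-cong (P? ∘ suc) (Q? ∘ suc) (P⊆Q , Q⊆P) N)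

count-∪ : ∀ {P Q : Pred ℕ 0ℓ} (P? : Decidable P) (Q? : Decidable Q) →
          (∀ {x} → P x → ¬ Q x) → ∀ N → count (P? ∪? Q?) N ≡ count P? N + count Q? N
count-∪ P? Q? disjoint zero    = refl
count-∪ {P} {Q} P? Q? disjoint (suc N) = begin
  indicator ((P? ∪? Q?) 0) + count (P? ∘ suc ∪? Q? ∘ suc) N
    ≡⟨ cong₂ _+_ (indicator-⊎ (P? 0) (Q? 0)) (count-∪ (P? ∘ suc) (Q? ∘ suc) disjoint N) ⟩
  (indicator (P? 0) + indicator (Q? 0)) + (count (P? ∘ suc) N + count (Q? ∘ suc) N)
    ≡⟨ interchange +-commutativeSemigroup (indicator (P? 0)) _ _ _ ⟩
  (indicator (P? 0) + count (P? ∘ suc) N) + (indicator (Q? 0) + count (Q? ∘ suc) N) ∎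
  where
  open ≡-Reasoning
  indicator-⊎ : (p? : Dec (P 0)) (q? : Dec (Q 0)) → indicator (p? ⊎-dec q?) ≡ indicator p? + indicator q?
  indicator-⊎ (yes p) (yes q) = contradiction q (disjoint p)
  indicator-⊎ (yes _) (no _)  = refl
  indicator-⊎ (no _)  (yes _) = refl
  indicator-⊎ (no _)  (no _)  = refl

count-+ : ∀ {P : Pred ℕ 0ℓ} (P? : Decidable P) m k → count P? (m + k) ≡ count P? m + count (P? ∘ (m +_)) k
count-+ P? zero    k = refl
count-+ P? (suc m) k =
  trans (cong (indicator (P? 0) +_) (count-+ (P? ∘ suc) m k)) (sym (+-assoc (indicator (P? 0)) _ _))

count≡0 : ∀ {P : Pred ℕ 0ℓ} (P? : Decidable P) N → (∀ {x} → x < N → ¬ P x) → count P? N ≡ 0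
count≡0 P? zero    none = refl
count≡0 P? (suc N) none with P? 0
... | yes P0 = contradiction P0 (none (s≤s z≤n))
... | no _   = count≡0 (P? ∘ suc) N (none ∘ s≤s)

count-< : ∀ {P : Pred ℕ 0ℓ} (P? : Decidable P) {x N} → x < N → P x → count P? x < count P? N
count-< {P} P? {x} {N} x<N Px with m≤n⇒∃[o]m+o≡n x<N
... | k , x+1+k≡N = begin-strict
  count P? x                                      <⟨ m<m+n _ (head-positive (P? (x + 0)) _) ⟩
  count P? x + count (P? ∘ (x +_)) (suc k)        ≡⟨ sym (count-+ P? x (suc k)) ⟩
  count P? (x + suc k)                            ≡⟨ cong (count P?) (trans (+-suc x k) x+1+k≡N) ⟩
  count P? N                                      ∎
  where
  open ≤-Reasoning
  head-positive : (d : Dec (P (x + 0))) → ∀ m → 0 < indicator d + m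
  head-positive (yes _)  m = s≤s z≤n
  head-positive (no ¬Px) m = contradiction (subst P (sym (+-identityʳ x)) Px) ¬Px

count-multiples : ∀ {P : Pred ℕ 0ℓ} (P? : Decidable P) d .{{_ : NonZero d}} → (∀ {x} → P x → d ∣ x) →
                  ∀ L → count P? (L * d) ≡ count (P? ∘ (_* d)) L
count-multiples P? d           only-multiples zero    = refl
count-multiples {P} P? d@(suc d-1) only-multiples (suc L) = begin
  count P? (d + L * d)                         ≡⟨ count-+ P? d (L * d) ⟩
  count P? d + count (P? ∘ (d +_)) (L * d)     ≡⟨ cong₂ _+_ first-block (count-multiples (P? ∘ (d +_)) d shifted L) ⟩
  indicator (P? 0) + count (λ y → P? (d + y * d)) L ∎
  where
  open ≡-Reasoning
  first-block : count P? d ≡ indicator (P? 0)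
  first-block = trans (cong (indicator (P? 0) +_)
                            (count≡0 (P? ∘ suc) d-1 λ x<d-1 → >⇒∤ (s≤s x<d-1) ∘ only-multiples))
                      (+-identityʳ _)
  shifted : ∀ {x} → P (d + x) → d ∣ x
  shifted Pd+x = ∣m+n∣m⇒∣n (only-multiples Pd+x) ∣-refl

∣x∷p∣≡indicator+∣p∣ : ∀ {n} {A : Set} (a? : Dec A) (p : Subset n) →
                     ∣ (if does a? then inside else outside) ∷ p ∣ ≡ indicator a? + ∣ p ∣
∣x∷p∣≡indicator+∣p∣ (yes _) p = refl
∣x∷p∣≡indicator+∣p∣ (no _)  p = refl

∣toSubset∣≡count : ∀ {n} {P : Pred (Fin n) 0ℓ} (P? : Decidable P) {R : Pred ℕ 0ℓ} (R? : Decidable R) →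
                   (∀ x → P x ⇔ R (toℕ x)) → ∣ toSubset P? ∣ ≡ count R? n
∣toSubset∣≡count {zero}  P? R? P⇔R = refl
∣toSubset∣≡count {suc n} P? R? P⇔R = trans (∣x∷p∣≡indicator+∣p∣ (P? F.zero) (toSubset (P? ∘ F.suc)))
  (cong₂ _+_ (indicator-cong (P⇔R F.zero) (P? F.zero) (R? 0))
             (∣toSubset∣≡count (P? ∘ F.suc) (R? ∘ suc) (P⇔R ∘ F.suc)))

∈toSubset⁻ : ∀ {n} {P : Pred (Fin n) 0ℓ} (P? : Decidable P) {x} → x ∈ toSubset P? → P x
∈toSubset⁻ P? {x} x∈P with P? x | trans (sym (lookup∘tabulate _ x)) ([]=⇒lookup x∈P)
... | yes Px | _  = Px
... | no _   | ()

∣p∪q∣≡∣p∣+∣q∣ : ∀ {n} (p q : Subset n) → Empty (p ∩ q) → ∣ p ∪ q ∣ ≡ ∣ p ∣ + ∣ q ∣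
∣p∪q∣≡∣p∣+∣q∣ []            []            _     = refl
∣p∪q∣≡∣p∣+∣q∣ (inside  ∷ p) (inside  ∷ q) empty = contradiction (F.zero , here) empty
∣p∪q∣≡∣p∣+∣q∣ (inside  ∷ p) (outside ∷ q) empty = cong suc (∣p∪q∣≡∣p∣+∣q∣ p q (drop-∷-Empty empty))
∣p∪q∣≡∣p∣+∣q∣ (outside ∷ p) (inside  ∷ q) empty =
  trans (cong suc (∣p∪q∣≡∣p∣+∣q∣ p q (drop-∷-Empty empty))) (sym (+-suc ∣ p ∣ ∣ q ∣))
∣p∪q∣≡∣p∣+∣q∣ (outside ∷ p) (outside ∷ q) empty = ∣p∪q∣≡∣p∣+∣q∣ p q (drop-∷-Empty empty)

p∣m*q⇒p∣m : ∀ {p q m} → Prime p → Prime q → p ≢ q → p ∣ m * q → p ∣ m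
p∣m*q⇒p∣m {p} {q} {m} p-prime q-prime p≢q p∣m*q with euclidsLemma m q p-prime p∣m*q
... | inj₁ p∣m = p∣m
... | inj₂ p∣q with prime⇒irreducible q-prime p∣q
...   | inj₁ p≡1 = contradiction (subst Prime p≡1 p-prime) ¬prime[1]
...   | inj₂ p≡q = contradiction p≡q p≢q

p∣m⇒q∣m⇒p*q∣m : ∀ {p q m} → Prime p → Prime q → p ≢ q → p ∣ m → q ∣ m → p * q ∣ m
p∣m⇒q∣m⇒p*q∣m {q = q} p-prime q-prime p≢q p∣m (divides k refl) =
  *-monoˡ-∣ q (p∣m*q⇒p∣m {m = k} p-prime q-prime p≢q p∣m)

m∣m^n : ∀ {m n} → 1 ≤ n → m ∣ m ^ n
m∣m^n {m} {suc n} _ = m∣m*n (m ^ n)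

nonZero-factor : ∀ {m k n} .{{_ : NonZero n}} → n ≡ m * k → NonZero m
nonZero-factor {k = k} {n} n≡m*k = ≢-nonZero λ m≡0 → ≢-nonZero⁻¹ n (trans n≡m*k (cong (_* k) m≡0))

quot*≡ : ∀ {m n} → m ∣ n → quot n m * m ≡ n
quot*≡ {zero}  m∣n = sym (0∣⇒≡0 m∣n)
quot*≡ {suc m} m∣n = m/n*n≡m m∣n

quot-nonZero : ∀ {m n} .{{_ : NonZero n}} → m ∣ n → NonZero (quot n m)
quot-nonZero m∣n = nonZero-factor (sym (quot*≡ m∣n))

quot<n : ∀ {m n} .{{_ : NonZero n}} → 1 < m → m ∣ n → quot n m < n
quot<n {m} {n} 1<m m∣n = subst (quot n m <_) (quot*≡ m∣n) (m<m*n (quot n m) m {{quot-nonZero m∣n}} 1<m)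

n∣quot*x⇔m∣x : ∀ {m n x} .{{_ : NonZero n}} → m ∣ n → (n ∣ quot n m * x) ⇔ (m ∣ x)
n∣quot*x⇔m∣x {m} {n} {x} m∣n = mk⇔
  (λ n∣kx → *-cancelˡ-∣ (quot n m) {{quot-nonZero m∣n}} (subst (_∣ quot n m * x) (sym (quot*≡ m∣n)) n∣kx))
  (λ m∣x → subst (_∣ quot n m * x) (quot*≡ m∣n) (*-monoʳ-∣ (quot n m) m∣x))

strictlyIncreasing⇒injective : ∀ {r} (f : Fin r → ℕ) → (∀ i j → i F.< j → f i < f j) → Injective _≡_ _≡_ f
strictlyIncreasing⇒injective f increasing {i} {j} fi≡fj with Finₚ.<-cmp i j
... | tri< i<j _ _ = contradiction fi≡fj (<⇒≢ (increasing i j i<j))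
... | tri≈ _ i≡j _ = i≡j
... | tri> _ _ j<i = contradiction (sym fi≡fj) (<⇒≢ (increasing j i j<i))

∃≢-both : ∀ {r} → 3 ≤ r → (a c : Fin r) → a ≢ c → ∃[ k ] k ≢ a × k ≢ c
∃≢-both {suc (suc (suc r))} (s≤s (s≤s (s≤s _))) a c a≢c = punchIn a k′ , punchInᵢ≢i a k′ , k≢c
  where
  c′ : Fin (suc (suc r))
  c′ = punchOut a≢c
  k′ : Fin (suc (suc r))
  k′ = punchIn c′ F.zero
  k≢c : punchIn a k′ ≢ c
  k≢c k≡c = punchInᵢ≢i c′ F.zero (punchIn-injective a k′ c′ (trans k≡c (sym (punchIn-punchOut a≢c))))

module Q1-Counting {r} (p : Fin r → ℕ) (p-prime : ∀ i → Prime (p i)) (p-injective : Injective _≡_ _≡_ p)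
         (n : ℕ) {{_ : NonZero n}} (p∣n : ∀ i → p i ∣ n) where

  private instance
    p-nonZero : ∀ {i} → NonZero (p i)
    p-nonZero {i} = prime⇒nonZero (p-prime i)

  p-distinct : ∀ {i j} → i ≢ j → p i ≢ p j
  p-distinct i≢j = i≢j ∘ p-injective

  pᵢpⱼ∣n : ∀ {i j} → i ≢ j → p i * p j ∣ n
  pᵢpⱼ∣n {i} {j} i≢j = p∣m⇒q∣m⇒p*q∣m (p-prime i) (p-prime j) (p-distinct i≢j) (p∣n i) (p∣n j)

  -- The decision procedure used in the definition of Q1, so that Q1 n r p a is toSubset (inQ1? a).
  inQ1? : ∀ a → Decidable (InQ1 n r p a)
  inQ1? a x = any? (λ i → ¬? (i F.≟ a) ×-dec (n ∣? (quot n (p i * p a) * toℕ x)))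

  OtherPrimeDivides : Fin r → Pred ℕ 0ℓ
  OtherPrimeDivides a y = ∃[ i ] i ≢ a × p i ∣ y

  otherPrimeDivides? : ∀ a → Decidable (OtherPrimeDivides a)
  otherPrimeDivides? a y = any? (λ i → ¬? (i F.≟ a) ×-dec p i ∣? y)

  ThirdPrimeDivides : Fin r → Fin r → Pred ℕ 0ℓ
  ThirdPrimeDivides a c y = ∃[ i ] i ≢ a × i ≢ c × p i ∣ y

  thirdPrimeDivides? : ∀ a c → Decidable (ThirdPrimeDivides a c)
  thirdPrimeDivides? a c y = any? (λ i → ¬? (i F.≟ a) ×-dec ¬? (i F.≟ c) ×-dec p i ∣? y)

  ThirdPrimeDivides-swap : ∀ {a c y} → ThirdPrimeDivides a c y → ThirdPrimeDivides c a y
  ThirdPrimeDivides-swap (i , i≢a , i≢c , pᵢ∣y) = i , i≢c , i≢a , pᵢ∣y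

  InQ1⇔ : ∀ a x → InQ1 n r p a x ⇔ (p a ∣ toℕ x × OtherPrimeDivides a (toℕ x))
  InQ1⇔ a x = mk⇔
    (λ (i , i≢a , n∣kx) → let pᵢpₐ∣x = Equivalence.to (n∣quot*x⇔m∣x (pᵢpⱼ∣n i≢a)) n∣kx in
       m*n∣⇒n∣ (p i) (p a) pᵢpₐ∣x , i , i≢a , m*n∣⇒m∣ (p i) (p a) pᵢpₐ∣x)
    (λ (pₐ∣x , i , i≢a , pᵢ∣x) → i , i≢a , Equivalence.from (n∣quot*x⇔m∣x (pᵢpⱼ∣n i≢a))
       (p∣m⇒q∣m⇒p*q∣m (p-prime i) (p-prime a) (p-distinct i≢a) pᵢ∣x pₐ∣x))

  ∣Q1∣≡count : ∀ a M → n ≡ M * p a → ∣ Q1 n r p a ∣ ≡ count (otherPrimeDivides? a) M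
  ∣Q1∣≡count a M n≡M*pₐ = begin
    ∣ Q1 n r p a ∣                      ≡⟨ ∣toSubset∣≡count (inQ1? a) R? (InQ1⇔ a) ⟩
    count R? n                          ≡⟨ cong (count R?) n≡M*pₐ ⟩
    count R? (M * p a)                  ≡⟨ count-multiples R? (p a) proj₁ M ⟩
    count (R? ∘ (_* p a)) M             ≡⟨ count-cong (R? ∘ (_* p a)) (otherPrimeDivides? a) (to , from) M ⟩
    count (otherPrimeDivides? a) M      ∎
    where
    open ≡-Reasoning
    R? : Decidable (λ x → p a ∣ x × OtherPrimeDivides a x)
    R? x = p a ∣? x ×-dec otherPrimeDivides? a x
    to : ∀ {y} → p a ∣ y * p a × OtherPrimeDivides a (y * p a) → OtherPrimeDivides a y
    to (_ , i , i≢a , pᵢ∣ypₐ) = i , i≢a , p∣m*q⇒p∣m (p-prime i) (p-prime a) (p-distinct i≢a) pᵢ∣ypₐ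
    from : ∀ {y} → OtherPrimeDivides a y → p a ∣ y * p a × OtherPrimeDivides a (y * p a)
    from {y} (i , i≢a , pᵢ∣y) = n∣m*n y , i , i≢a , ∣m⇒∣m*n (p a) pᵢ∣y

  count-otherPrimeDivides : ∀ a c → c ≢ a → ∀ L →
    count (otherPrimeDivides? a) (L * p c) ≡
    count (thirdPrimeDivides? a c) (L * p c) + count (∁? (thirdPrimeDivides? a c)) L
  count-otherPrimeDivides a c c≢a L = begin
    count (otherPrimeDivides? a) (L * p c)
      ≡⟨ count-cong (otherPrimeDivides? a) (third? ∪? onlyC?) (split , merge) (L * p c) ⟩
    count (third? ∪? onlyC?) (L * p c)
      ≡⟨ count-∪ third? onlyC? (λ t (_ , ¬t) → ¬t t) (L * p c) ⟩
    count third? (L * p c) + count onlyC? (L * p c)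
      ≡⟨ cong (count third? (L * p c) +_) (count-multiples onlyC? (p c) proj₁ L) ⟩
    count third? (L * p c) + count (onlyC? ∘ (_* p c)) L
      ≡⟨ cong (count third? (L * p c) +_) (count-cong (onlyC? ∘ (_* p c)) (∁? third?) (scaled⇒¬third , ¬third⇒scaled) L) ⟩
    count third? (L * p c) + count (∁? third?) L ∎
    where
    open ≡-Reasoning
    third? : Decidable (ThirdPrimeDivides a c)
    third? = thirdPrimeDivides? a c
    OnlyC : Pred ℕ 0ℓ
    OnlyC y = p c ∣ y × ¬ ThirdPrimeDivides a c y
    onlyC? : Decidable OnlyC
    onlyC? y = p c ∣? y ×-dec ∁? third? y
    split : ∀ {y} → OtherPrimeDivides a y → ThirdPrimeDivides a c y ⊎ OnlyC y
    split {y} (i , i≢a , pᵢ∣y) with third? y | i F.≟ c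
    ... | yes t  | _        = inj₁ t
    ... | no ¬t  | yes refl = inj₂ (pᵢ∣y , ¬t)
    ... | no ¬t  | no i≢c   = contradiction (i , i≢a , i≢c , pᵢ∣y) ¬t
    merge : ∀ {y} → ThirdPrimeDivides a c y ⊎ OnlyC y → OtherPrimeDivides a y
    merge (inj₁ (i , i≢a , _ , pᵢ∣y)) = i , i≢a , pᵢ∣y
    merge (inj₂ (p꜀∣y , _))           = c , c≢a , p꜀∣y
    third-cancel : ∀ {y} → ThirdPrimeDivides a c (y * p c) → ThirdPrimeDivides a c y
    third-cancel (i , i≢a , i≢c , pᵢ∣yp꜀) = i , i≢a , i≢c , p∣m*q⇒p∣m (p-prime i) (p-prime c) (p-distinct i≢c) pᵢ∣yp꜀
    ¬third⇒scaled : ∀ {y} → ¬ ThirdPrimeDivides a c y → OnlyC (y * p c)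
    ¬third⇒scaled {y} ¬t = n∣m*n y , ¬t ∘ third-cancel
    scaled⇒¬third : ∀ {y} → OnlyC (y * p c) → ¬ ThirdPrimeDivides a c y
    scaled⇒¬third (_ , ¬t) (i , i≢a , i≢c , pᵢ∣y) = ¬t (i , i≢a , i≢c , ∣m⇒∣m*n (p c) pᵢ∣y)

  ∣Q1∣≡count-third : ∀ a c → c ≢ a → ∀ L → n ≡ L * p c * p a →
    ∣ Q1 n r p a ∣ ≡ count (thirdPrimeDivides? a c) (L * p c) + count (∁? (thirdPrimeDivides? a c)) L
  ∣Q1∣≡count-third a c c≢a L n≡ = trans (∣Q1∣≡count a (L * p c) n≡) (count-otherPrimeDivides a c c≢a L)

  ∣Q1∣-decreasing : ∀ {a c} → ∃[ k ] k ≢ a × k ≢ c → p a < p c → ∣ Q1 n r p c ∣ < ∣ Q1 n r p a ∣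
  ∣Q1∣-decreasing {a} {c} (k , k≢a , k≢c) pₐ<p꜀ = begin-strict
    ∣ Q1 n r p c ∣
      ≡⟨ ∣Q1∣≡count-third c a a≢c L n≡L*pₐ*p꜀ ⟩
    count (third? c a) (L * p a) + count (∁? (third? c a)) L
      ≡⟨ cong₂ _+_ (count-cong (third? c a) (third? a c) (swap , swap) (L * p a))
                   (count-cong (∁? (third? c a)) (∁? (third? a c)) ((_∘ swap) , (_∘ swap)) L) ⟩
    count (third? a c) (L * p a) + count (∁? (third? a c)) L
      <⟨ +-monoˡ-< _ (count-< (third? a c) (*-monoʳ-< L {{L≢0}} pₐ<p꜀) (k , k≢a , k≢c , pₖ∣Lpₐ)) ⟩
    count (third? a c) (L * p c) + count (∁? (third? a c)) L
      ≡⟨ ∣Q1∣≡count-third a c (a≢c ∘ sym) L n≡L*p꜀*pₐ ⟨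
    ∣ Q1 n r p a ∣ ∎
    where
    open ≤-Reasoning
    third? : ∀ a c → Decidable (ThirdPrimeDivides a c)
    third? = thirdPrimeDivides?
    swap : ∀ {a c y} → ThirdPrimeDivides a c y → ThirdPrimeDivides c a y
    swap = ThirdPrimeDivides-swap
    a≢c : a ≢ c
    a≢c a≡c = <⇒≢ pₐ<p꜀ (cong p a≡c)
    L : ℕ
    L = quotient (pᵢpⱼ∣n a≢c)
    n≡L*pₐp꜀ : n ≡ L * (p a * p c)
    n≡L*pₐp꜀ = _∣_.equality (pᵢpⱼ∣n a≢c)
    n≡L*pₐ*p꜀ : n ≡ L * p a * p c
    n≡L*pₐ*p꜀ = trans n≡L*pₐp꜀ (sym (*-assoc L (p a) (p c)))
    n≡L*p꜀*pₐ : n ≡ L * p c * p a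
    n≡L*p꜀*pₐ = trans n≡L*pₐp꜀ (trans (cong (L *_) (*-comm (p a) (p c))) (sym (*-assoc L (p c) (p a))))
    L≢0 : NonZero L
    L≢0 = nonZero-factor n≡L*pₐp꜀
    pₖ∣Lpₐ : p k ∣ L * p a
    pₖ∣Lpₐ = p∣m*q⇒p∣m (p-prime k) (p-prime c) (p-distinct k≢c) (subst (p k ∣_) n≡L*pₐ*p꜀ (p∣n k))

  order-n∉Q1 : ∀ a x → HasOrder n n x → ¬ InQ1 n r p a x
  order-n∉Q1 a x (_ , no-proper-multiple) (i , i≢a , n∣kx) =
    no-proper-multiple (fromℕ< k<n) (subst (0 <_) (sym (toℕ-fromℕ< k<n)) 0<k)
                       (subst (λ j → n ∣ j * toℕ x) (sym (toℕ-fromℕ< k<n)) n∣kx)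
    where
    k : ℕ
    k = quot n (p i * p a)
    1<pᵢpₐ : 1 < p i * p a
    1<pᵢpₐ = <-≤-trans (nonTrivial⇒n>1 (p i) {{prime⇒nonTrivial (p-prime i)}}) (m≤m*n (p i) (p a))
    k<n : k < n
    k<n = quot<n 1<pᵢpₐ (pᵢpⱼ∣n i≢a)
    0<k : 0 < k
    0<k = >-nonZero⁻¹ k {{quot-nonZero (pᵢpⱼ∣n i≢a)}}

  ∣Z1∣≡∣E∣+∣Q1∣ : ∀ a → ∣ Z1 n r p a ∣ ≡ ∣ E n n ∣ + ∣ Q1 n r p a ∣
  ∣Z1∣≡∣E∣+∣Q1∣ a = ∣p∪q∣≡∣p∣+∣q∣ (E n n) (Q1 n r p a) λ (x , x∈E∩Q) →
    let x∈E , x∈Q = x∈p∩q⁻ (E n n) (Q1 n r p a) x∈E∩Q in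
    order-n∉Q1 a x (∈toSubset⁻ (hasOrder? n n) x∈E) (∈toSubset⁻ (inQ1? a) x∈Q)

lemma2p4 : (r : ℕ) → 3 ≤ r → (p e : Fin r → ℕ) →
           (∀ i → Prime (p i)) → (∀ i j → i F.< j → p i < p j) →
           (∀ i → 1 ≤ e i) → (n : ℕ) → n ≡ prodFin r (λ i → p i ^ e i) →
           (a b : Fin r) → a F.< b →
           (∣ Q1 n r p b ∣ < ∣ Q1 n r p a ∣) × (∣ Z1 n r p b ∣ < ∣ Z1 n r p a ∣)
lemma2p4 r 3≤r p e p-prime p-increasing e≥1 n n≡∏ a b a<b = ∣Q1b∣<∣Q1a∣ , ∣Z1b∣<∣Z1a∣
  where
  instance
    n≢0 : NonZero n
    n≢0 = subst NonZero (sym n≡∏) (product≢0 (tabulate⁺ λ i → m^n≢0 (p i) (e i) {{prime⇒nonZero (p-prime i)}}))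
  p∣n : ∀ i → p i ∣ n
  p∣n i = subst (p i ∣_) (sym n≡∏) (∣-trans (m∣m^n (e≥1 i)) (∈⇒∣product (∈-tabulate⁺ i)))
  open Q1-Counting p p-prime (strictlyIncreasing⇒injective p p-increasing) n p∣n
  ∣Q1b∣<∣Q1a∣ : ∣ Q1 n r p b ∣ < ∣ Q1 n r p a ∣
  ∣Q1b∣<∣Q1a∣ = ∣Q1∣-decreasing (∃≢-both 3≤r a b (Finₚ.<⇒≢ a<b)) (p-increasing a b a<b)
  ∣Z1b∣<∣Z1a∣ : ∣ Z1 n r p b ∣ < ∣ Z1 n r p a ∣
  ∣Z1b∣<∣Z1a∣ = subst₂ _<_ (sym (∣Z1∣≡∣E∣+∣Q1∣ b)) (sym (∣Z1∣≡∣E∣+∣Q1∣ a)) (+-monoʳ-< ∣ E n n ∣ ∣Q1b∣<∣Q1a∣)
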